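{- Let $a,b,k$ be integers with $k\ge b>a\ge 1$. The set $\mathcal{R}'_{a,b,k}$ of partitions all of whose parts are congruent to $a$ or $b$ modulo $k$, in which only parts congruent to $b$ modulo $k$ may be repeated, is a separable integer partition class with modulus $k$.
   Context: A partition is a finite non-increasing sequence of positive integers. For a positive integer $k$, a set $\mathcal{P}$ of partitions is a separable integer partition class with modulus $k$ if there is a subset $\mathcal{B}\subset\mathcal{P}$ (the basis) such that for each integer $m\ge1$ the number of partitions in $\mathcal{B}$ with $m$ parts is finite, every partition in $\mathcal{P}$ with $m$ parts is uniquely of the form $(b_1+\pi_1,\dots,b_m+\pi_m)$ where $(b_1,\dots,b_m)\in\mathcal{B}$ and $(\pi_1,\dots,\pi_m)$ is a non-increasing sequence of nonnegative integers each divisible by $k$, and all partitions of this form lie in $\mathcal{P}$. -}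

module Defs where

open import Level using (0ℓ)
open import Data.Nat using (ℕ; _+_; _*_; _<_; _≥_; _≤_)
open import Data.List using (List; length; zipWith; lookup)
open import Data.List.Relation.Unary.All using (All)
open import Data.List.Relation.Unary.Linked using (Linked)
open import Data.List.Membership.Propositional using (_∈_)
open import Data.Fin using (Fin)
open import Data.Product using (Σ; ∃; _×_)
open import Data.Sum using (_⊎_)
open import Relation.Nullary using (¬_)
open import Relation.Binary.PropositionalEquality using (_≡_)

_≡_[mod_] : ℕ → ℕ → ℕ → Set
x ≡ y [mod k ] = ∃ λ q → (x ≡ y + q * k) ⊎ (y ≡ x + q * k)

IsPartition : List ℕ → Set
IsPartition λ′ = Linked _≥_ λ′ × All (λ x → 0 < x) λ′

PartitionSet : Set₁
PartitionSet = List ℕ → Set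

IsShift : ℕ → List ℕ → Set
IsShift k π = Linked _≥_ π × All (λ x → ∃ λ q → x ≡ q * k) π

Decomp : (B : PartitionSet) → ℕ → List ℕ → List ℕ → List ℕ → Set
Decomp B k λ′ β π =
  B β × length β ≡ length λ′ × length π ≡ length λ′ × IsShift k π × λ′ ≡ zipWith _+_ β π

IsSeparable : ℕ → PartitionSet → Set₁
IsSeparable k P =
  Σ PartitionSet λ B →
    (∀ β → B β → P β)
    × (∀ m → 1 ≤ m → ∃ λ (L : List (List ℕ)) → ∀ β → B β → length β ≡ m → β ∈ L)
    × (∀ λ′ → P λ′ → ∃ λ β → ∃ λ π → Decomp B k λ′ β π)
    × (∀ λ′ β π β′ π′ → P λ′ → Decomp B k λ′ β π → Decomp B k λ′ β′ π′ → β ≡ β′ × π ≡ π′)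
    × (∀ β π → B β → IsShift k π → length π ≡ length β → P (zipWith _+_ β π))

R′ : ℕ → ℕ → ℕ → PartitionSet
R′ a b k λ′ =
  IsPartition λ′
  × All (λ x → (x ≡ a [mod k ]) ⊎ (x ≡ b [mod k ])) λ′
  × (∀ (i j : Fin (length λ′)) → ¬ (i ≡ j) → lookup λ′ i ≡ lookup λ′ j →
       lookup λ′ i ≡ b [mod k ])

{-# OPTIONS --safe #-}
-- Every part of a partition in R′ is uniquely r + q·k with r ∈ {a, b}, and since
-- 1 ≤ a < b ≤ k this encoding is monotone in (q, r) taken lexicographically.  The
-- conditions defining R′ therefore say exactly that consecutive parts r + q·k, r′ + q′·k
-- satisfy q ≥ q′ + [r = a].  For a fixed sequence of residues the least quotients
-- satisfying this give the basis partition, and the quotients of any member of R′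
-- exceed them by a non-increasing sequence, i.e. by a shift divided by k.
module Submission where

open import Defs
open import Data.Nat using (ℕ; zero; suc; _+_; _*_; _≤_; _<_; _≥_; s≤s; z≤n; >-nonZero)
open import Data.Nat.Properties
open import Data.List using (List; []; _∷_; length; map; zipWith; lookup; cartesianProductWith)
open import Data.List.Properties using (∷-injectiveˡ; ∷-injectiveʳ; length-map; map-injective)
open import Data.List.Membership.Propositional using (_∈_)
open import Data.List.Membership.Propositional.Properties using (∈-map⁺; ∈-cartesianProductWith⁺)
open import Data.List.Relation.Unary.Any using (here; there)
open import Data.List.Relation.Unary.All as All using (All; []; _∷_)
import Data.List.Relation.Unary.All.Properties as All
open import Data.List.Relation.Unary.Linked as Linked using (Linked; []; [-]; _∷_)
import Data.List.Relation.Unary.Linked.Properties as Linked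
open import Data.Fin as Fin using (Fin)
import Data.Fin.Properties as Fin
open import Data.Maybe.Relation.Binary.Connected using (just)
open import Data.Product using (∃; _×_; _,_; proj₁; proj₂)
open import Data.Sum using (_⊎_; inj₁; inj₂)
import Data.Sum as Sum
open import Data.Empty using (⊥-elim)
open import Function using (_∘_; flip; case_of_)
open import Relation.Nullary using (¬_)
open import Relation.Binary.Definitions using (tri<; tri≈; tri>)
open import Relation.Binary.PropositionalEquality

Descent : (ℕ → Set) → ℕ → ℕ → Set
Descent P x y = y ≤ x × (y < x ⊎ P x)

RepeatsOnly : (ℕ → Set) → List ℕ → Set
RepeatsOnly P xs = ∀ (i j : Fin (length xs)) → ¬ i ≡ j → lookup xs i ≡ lookup xs j → P (lookup xs i)

lookup-≤-head : ∀ {y ys} → Linked _≥_ (y ∷ ys) → ∀ j → lookup (y ∷ ys) j ≤ y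
lookup-≤-head l = Linked.lookup (flip ≤-trans) l (just ≤-refl)

repeatsOnly⇒descent : ∀ {P xs} → Linked _≥_ xs → RepeatsOnly P xs → Linked (Descent P) xs
repeatsOnly⇒descent [] _ = []
repeatsOnly⇒descent [-] _ = [-]
repeatsOnly⇒descent (y≤x ∷ l) repeats =
  (y≤x , Sum.map₂ (λ y≡x → repeats Fin.zero (Fin.suc Fin.zero) (λ ()) (sym y≡x)) (m≤n⇒m<n∨m≡n y≤x))
  ∷ repeatsOnly⇒descent l (λ i j i≢j → repeats (Fin.suc i) (Fin.suc j) (i≢j ∘ Fin.suc-injective))

descent-repeated-head : ∀ {P x y ys} → Descent P x y → Linked (Descent P) (y ∷ ys) →
                        ∀ j → x ≡ lookup (y ∷ ys) j → P x
descent-repeated-head (_ , inj₂ Px) _ _ _ = Px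
descent-repeated-head (_ , inj₁ y<x) l j x≡yⱼ =
  ⊥-elim (<⇒≱ y<x (subst (_≤ _) (sym x≡yⱼ) (lookup-≤-head (Linked.map proj₁ l) j)))

descent⇒repeatsOnly : ∀ {P xs} → Linked (Descent P) xs → RepeatsOnly P xs
descent⇒repeatsOnly [-] Fin.zero Fin.zero i≢j _ = ⊥-elim (i≢j refl)
descent⇒repeatsOnly (_ ∷ _) Fin.zero Fin.zero i≢j _ = ⊥-elim (i≢j refl)
descent⇒repeatsOnly (d ∷ l) Fin.zero (Fin.suc j) _ x≡yⱼ = descent-repeated-head d l j x≡yⱼ
descent⇒repeatsOnly {P} (d ∷ l) (Fin.suc i) Fin.zero _ yᵢ≡x =
  subst P (sym yᵢ≡x) (descent-repeated-head d l i (sym yᵢ≡x))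
descent⇒repeatsOnly (_ ∷ l) (Fin.suc i) (Fin.suc j) i≢j =
  descent⇒repeatsOnly l i j (i≢j ∘ cong Fin.suc)

≡[mod]-canonical : ∀ {x r k} → 0 < x → r ≤ k → x ≡ r [mod k ] → ∃ λ q → x ≡ r + q * k
≡[mod]-canonical _ _ (q , inj₁ x≡r+qk) = q , x≡r+qk
≡[mod]-canonical {x} {r} _ _ (zero , inj₂ r≡x+0) =
  0 , trans (sym (+-identityʳ x)) (trans (sym r≡x+0) (sym (+-identityʳ r)))
≡[mod]-canonical {x} {r} {k} 0<x r≤k (suc q , inj₂ r≡x+k+qk) = ⊥-elim (<⇒≱ k<r r≤k)
  where
  open ≤-Reasoning
  k<r : k < r
  k<r = begin-strict
    k             <⟨ m<n+m k 0<x ⟩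
    x + k         ≤⟨ +-monoʳ-≤ x (m≤m+n k (q * k)) ⟩
    x + suc q * k ≡⟨ sym r≡x+k+qk ⟩
    r             ∎

All-preimage : ∀ {A B : Set} {f : A → B} {ys} → All (λ y → ∃ λ x → y ≡ f x) ys → ∃ λ xs → ys ≡ map f xs
All-preimage [] = [] , refl
All-preimage ((x , refl) ∷ preimages) with All-preimage preimages
... | xs , refl = x ∷ xs , refl

shift-quotients : ∀ {k π} → IsShift k π → ∃ λ cs → π ≡ map (_* k) cs
shift-quotients {k} (_ , multiples) = All-preimage {f = _* k} multiples

shift-quotients-decreasing : ∀ {k cs} → 0 < k → Linked _≥_ (map (_* k) cs) → Linked _≥_ cs
shift-quotients-decreasing {k} 0<k l =
  Linked.map (λ {c} {c′} → *-cancelʳ-≤ c′ c k {{>-nonZero 0<k}}) (Linked.map⁻ l)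

decreasing-quotients-shift : ∀ {k cs} → Linked _≥_ cs → IsShift k (map (_* k) cs)
decreasing-quotients-shift {k} {cs} l =
  Linked.map⁺ (Linked.map (*-monoˡ-≤ k) l) , All.map⁺ (All.universal (λ c → c , refl) cs)

zipWith-+-cancelˡ : ∀ {xs ys zs} → length ys ≡ length xs → length zs ≡ length xs →
                    zipWith _+_ xs ys ≡ zipWith _+_ xs zs → ys ≡ zs
zipWith-+-cancelˡ {[]} {[]} {[]} _ _ _ = refl
zipWith-+-cancelˡ {[]} {_ ∷ _} ()
zipWith-+-cancelˡ {[]} {[]} {_ ∷ _} _ ()
zipWith-+-cancelˡ {_ ∷ _} {[]} ()
zipWith-+-cancelˡ {_ ∷ _} {_ ∷ _} {[]} _ ()
zipWith-+-cancelˡ {x ∷ xs} {y ∷ ys} {z ∷ zs} |ys| |zs| eq =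
  cong₂ _∷_ (+-cancelˡ-≡ x y z (∷-injectiveˡ eq))
            (zipWith-+-cancelˡ (suc-injective |ys|) (suc-injective |zs|) (∷-injectiveʳ eq))

-- A code (t , q) stands for the part r + q·k, where r is a or b according to t (see ⟦_⟧).
data Kind : Set where
  kindA kindB : Kind

δ : Kind → ℕ
δ kindA = 1
δ kindB = 0

_≽_ : Kind × ℕ → Kind × ℕ → Set
(t , q) ≽ (_ , q′) = δ t + q′ ≤ q

least-quotient : Kind → List Kind → ℕ
least-quotient t [] = 0
least-quotient t (u ∷ us) = δ t + least-quotient u us

ground : List Kind → List (Kind × ℕ)
ground [] = []
ground (t ∷ ts) = (t , least-quotient t ts) ∷ ground ts

raise : Kind × ℕ → ℕ → Kind × ℕ
raise (t , q) c = t , q + c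

length-ground : ∀ ts → length (ground ts) ≡ length ts
length-ground [] = refl
length-ground (t ∷ ts) = cong suc (length-ground ts)

ground-≽ : ∀ ts → Linked _≽_ (ground ts)
ground-≽ [] = []
ground-≽ (t ∷ []) = [-]
ground-≽ (t ∷ u ∷ us) = ≤-refl ∷ ground-≽ (u ∷ us)

raise-≽ : ∀ {p p′ c c′} → p ≽ p′ → c′ ≤ c → raise p c ≽ raise p′ c′
raise-≽ {t , q} {_ , q′} {c} {c′} p≽p′ c′≤c = subst (_≤ q + c) (+-assoc (δ t) q′ c′) (+-mono-≤ p≽p′ c′≤c)

raise-linked : ∀ {ps cs} → Linked _≽_ ps → Linked _≥_ cs → Linked _≽_ (zipWith raise ps cs)
raise-linked [] _ = []
raise-linked [-] [] = []
raise-linked [-] [-] = [-]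
raise-linked [-] (_ ∷ _) = [-]
raise-linked (_ ∷ _) [] = []
raise-linked (_ ∷ _) [-] = [-]
raise-linked {p ∷ p′ ∷ _} (p≽p′ ∷ l) (c′≤c ∷ l′) = raise-≽ {p} {p′} p≽p′ c′≤c ∷ raise-linked l l′

≽-linked⇒raised-ground : ∀ {ps} → Linked _≽_ ps →
  ∃ λ cs → Linked _≥_ cs × length cs ≡ length ps × ps ≡ zipWith raise (ground (map proj₁ ps)) cs
≽-linked⇒raised-ground [] = [] , [] , refl , refl
≽-linked⇒raised-ground {(_ , q) ∷ []} [-] = q ∷ [] , [-] , refl , refl
≽-linked⇒raised-ground {(t , q) ∷ (u , q′) ∷ ps} (p≽p′ ∷ l) with ≽-linked⇒raised-ground l
... | [] , _ , () , _
... | c′ ∷ cs , l′ , |cs| , ps≡ =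
  c′ + e ∷ c′ ∷ cs , m≤m+n c′ e ∷ l′ , cong suc |cs| , cong₂ _∷_ (cong (t ,_) q≡) ps≡
  where
  e = proj₁ (m≤n⇒∃[o]m+o≡n p≽p′)
  g = least-quotient u (map proj₁ ps)
  q≡ : q ≡ δ t + g + (c′ + e)
  q≡ = begin
    q                    ≡⟨ sym (proj₂ (m≤n⇒∃[o]m+o≡n p≽p′)) ⟩
    δ t + q′ + e         ≡⟨ cong (λ x → δ t + x + e) (cong proj₂ (∷-injectiveˡ ps≡)) ⟩
    δ t + (g + c′) + e   ≡⟨ +-assoc (δ t) (g + c′) e ⟩
    δ t + (g + c′ + e)   ≡⟨ cong (δ t +_) (+-assoc g c′ e) ⟩
    δ t + (g + (c′ + e)) ≡⟨ sym (+-assoc (δ t) g (c′ + e)) ⟩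
    δ t + g + (c′ + e)   ∎
    where open ≡-Reasoning

kinds-raise-ground : ∀ {ts cs} → length cs ≡ length ts → map proj₁ (zipWith raise (ground ts) cs) ≡ ts
kinds-raise-ground {[]} {[]} _ = refl
kinds-raise-ground {[]} {_ ∷ _} ()
kinds-raise-ground {_ ∷ _} {[]} ()
kinds-raise-ground {t ∷ ts} {_ ∷ _} |cs| = cong (t ∷_) (kinds-raise-ground (suc-injective |cs|))

kindLists : ℕ → List (List Kind)
kindLists zero = [] ∷ []
kindLists (suc m) = cartesianProductWith _∷_ (kindA ∷ kindB ∷ []) (kindLists m)

∈-kindLists : ∀ ts → ts ∈ kindLists (length ts)
∈-kindLists [] = here refl
∈-kindLists (t ∷ ts) = ∈-cartesianProductWith⁺ _∷_ (kind∈ t) (∈-kindLists ts)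
  where
  kind∈ : ∀ t → t ∈ kindA ∷ kindB ∷ []
  kind∈ kindA = here refl
  kind∈ kindB = there (here refl)

module Residues {a b k : ℕ} (1≤a : 1 ≤ a) (a<b : a < b) (b≤k : b ≤ k) where

  residue : Kind → ℕ
  residue kindA = a
  residue kindB = b

  ⟦_⟧ : Kind × ℕ → ℕ
  ⟦ t , q ⟧ = residue t + q * k

  0<residue : ∀ t → 0 < residue t
  0<residue kindA = 1≤a
  0<residue kindB = ≤-trans (s≤s z≤n) a<b

  residue≤k : ∀ t → residue t ≤ k
  residue≤k kindA = <⇒≤ (<-≤-trans a<b b≤k)
  residue≤k kindB = b≤k

  residue-injective : ∀ {t u} → residue t ≡ residue u → t ≡ u
  residue-injective {kindA} {kindA} _ = refl
  residue-injective {kindA} {kindB} a≡b = ⊥-elim (<⇒≢ a<b a≡b)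
  residue-injective {kindB} {kindA} b≡a = ⊥-elim (<⇒≢ a<b (sym b≡a))
  residue-injective {kindB} {kindB} _ = refl

  0<k : 0 < k
  0<k = ≤-trans (0<residue kindB) b≤k

  ⟦⟧-<-quotient : ∀ {t u q q′} → q < q′ → ⟦ t , q ⟧ < ⟦ u , q′ ⟧
  ⟦⟧-<-quotient {t} {u} {q} {q′} q<q′ = begin-strict
    residue t + q * k  ≤⟨ +-monoˡ-≤ (q * k) (residue≤k t) ⟩
    suc q * k          ≤⟨ *-monoˡ-≤ k q<q′ ⟩
    q′ * k             <⟨ m<n+m (q′ * k) (0<residue u) ⟩
    residue u + q′ * k ∎
    where open ≤-Reasoning

  ⟦kindA⟧-≤ : ∀ {u q q′} → q ≤ q′ → ⟦ kindA , q ⟧ ≤ ⟦ u , q′ ⟧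
  ⟦kindA⟧-≤ {u} q≤q′ with m≤n⇒m<n∨m≡n q≤q′
  ... | inj₁ q<q′ = <⇒≤ (⟦⟧-<-quotient {kindA} {u} q<q′)
  ... | inj₂ refl = +-monoˡ-≤ _ (a≤residue u)
    where
    a≤residue : ∀ u → a ≤ residue u
    a≤residue kindA = ≤-refl
    a≤residue kindB = <⇒≤ a<b

  ⟦⟧-≤-kindB : ∀ {t q} → ⟦ t , q ⟧ ≤ ⟦ kindB , q ⟧
  ⟦⟧-≤-kindB {kindA} = +-monoˡ-≤ _ (<⇒≤ a<b)
  ⟦⟧-≤-kindB {kindB} = ≤-refl

  ⟦⟧-injective : ∀ {p p′} → ⟦ p ⟧ ≡ ⟦ p′ ⟧ → p ≡ p′
  ⟦⟧-injective {t , q} {u , q′} eq with <-cmp q q′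
  ... | tri< q<q′ _ _ = ⊥-elim (<⇒≢ (⟦⟧-<-quotient {t} {u} q<q′) eq)
  ... | tri> _ _ q′<q = ⊥-elim (<⇒≢ (⟦⟧-<-quotient {u} {t} q′<q) (sym eq))
  ... | tri≈ _ refl _ = cong (_, q) (residue-injective (+-cancelʳ-≡ (q * k) (residue t) (residue u) eq))

  ⟦raise⟧ : ∀ p c → ⟦ raise p c ⟧ ≡ ⟦ p ⟧ + c * k
  ⟦raise⟧ (t , q) c = begin
    residue t + (q + c) * k     ≡⟨ cong (residue t +_) (*-distribʳ-+ k q c) ⟩
    residue t + (q * k + c * k) ≡⟨ sym (+-assoc (residue t) (q * k) (c * k)) ⟩
    residue t + q * k + c * k   ∎
    where open ≡-Reasoning

  ⟦kindA⟧-≢b : ∀ {q} → ¬ ⟦ kindA , q ⟧ ≡ b [mod k ]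
  ⟦kindA⟧-≢b {q} (c , inj₁ eq) = case ⟦⟧-injective {kindA , q} {kindB , c} eq of λ ()
  ⟦kindA⟧-≢b {q} (c , inj₂ eq) = case ⟦⟧-injective {kindA , q + c} {kindB , 0} a+⟨q+c⟩k≡b+0 of λ ()
    where
    a+⟨q+c⟩k≡b+0 : ⟦ kindA , q + c ⟧ ≡ b + 0
    a+⟨q+c⟩k≡b+0 = trans (⟦raise⟧ (kindA , q) c) (trans (sym eq) (sym (+-identityʳ b)))

  ⟦⟧-positive : ∀ p → 0 < ⟦ p ⟧
  ⟦⟧-positive (t , q) = <-≤-trans (0<residue t) (m≤m+n (residue t) (q * k))

  ⟦⟧-residue : ∀ p → (⟦ p ⟧ ≡ a [mod k ]) ⊎ (⟦ p ⟧ ≡ b [mod k ])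
  ⟦⟧-residue (kindA , q) = inj₁ (q , inj₁ refl)
  ⟦⟧-residue (kindB , q) = inj₂ (q , inj₁ refl)

  residue-code : ∀ {x} → 0 < x × ((x ≡ a [mod k ]) ⊎ (x ≡ b [mod k ])) → ∃ λ p → x ≡ ⟦ p ⟧
  residue-code (0<x , inj₁ x≡a) =
    let q , eq = ≡[mod]-canonical 0<x (residue≤k kindA) x≡a in (kindA , q) , eq
  residue-code (0<x , inj₂ x≡b) =
    let q , eq = ≡[mod]-canonical 0<x (residue≤k kindB) x≡b in (kindB , q) , eq

  ≽⇒descent : ∀ {p p′} → p ≽ p′ → Descent (_≡ b [mod k ]) ⟦ p ⟧ ⟦ p′ ⟧
  ≽⇒descent {kindA , q} {u , q′} q′<q = <⇒≤ lt , inj₁ lt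
    where lt = ⟦⟧-<-quotient {u} {kindA} q′<q
  ≽⇒descent {kindB , q} {u , q′} q′≤q with m≤n⇒m<n∨m≡n q′≤q
  ... | inj₁ q′<q = <⇒≤ lt , inj₁ lt
    where lt = ⟦⟧-<-quotient {u} {kindB} q′<q
  ... | inj₂ refl = ⟦⟧-≤-kindB {u} {q} , inj₂ (q , inj₁ refl)

  descent⇒≽ : ∀ {p p′} → Descent (_≡ b [mod k ]) ⟦ p ⟧ ⟦ p′ ⟧ → p ≽ p′
  descent⇒≽ {kindA , q} {u , q′} (_ , inj₁ lt) = ≰⇒> (λ q≤q′ → <⇒≱ lt (⟦kindA⟧-≤ {u} {q} {q′} q≤q′))
  descent⇒≽ {kindA , q} (_ , inj₂ ≡b) = ⊥-elim (⟦kindA⟧-≢b {q} ≡b)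
  descent⇒≽ {kindB , q} {u , q′} (le , _) = ≮⇒≥ (λ q<q′ → <⇒≱ (⟦⟧-<-quotient {kindB} {u} q<q′) le)

  R′⇒≽-codes : ∀ {xs} → R′ a b k xs → ∃ λ ps → Linked _≽_ ps × xs ≡ map ⟦_⟧ ps
  R′⇒≽-codes ((decreasing , positive) , residues , repeats)
    with All-preimage (All.zipWith residue-code (positive , residues))
  ... | ps , refl = ps , Linked.map descent⇒≽ (Linked.map⁻ {f = ⟦_⟧} descent) , refl
    where descent = repeatsOnly⇒descent {P = _≡ b [mod k ]} decreasing repeats

  ≽-codes⇒R′ : ∀ {ps} → Linked _≽_ ps → R′ a b k (map ⟦_⟧ ps)
  ≽-codes⇒R′ {ps} l =
    (Linked.map proj₁ descent , All.map⁺ (All.universal ⟦⟧-positive ps)) ,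
    All.map⁺ (All.universal ⟦⟧-residue ps) ,
    descent⇒repeatsOnly descent
    where
    descent : Linked (Descent (_≡ b [mod k ])) (map ⟦_⟧ ps)
    descent = Linked.map⁺ (Linked.map ≽⇒descent l)

  map-⟦⟧-raise : ∀ ps cs → map ⟦_⟧ (zipWith raise ps cs) ≡ zipWith _+_ (map ⟦_⟧ ps) (map (_* k) cs)
  map-⟦⟧-raise [] _ = refl
  map-⟦⟧-raise (_ ∷ _) [] = refl
  map-⟦⟧-raise (p ∷ ps) (c ∷ cs) = cong₂ _∷_ (⟦raise⟧ p c) (map-⟦⟧-raise ps cs)

  basis : List Kind → List ℕ
  basis ts = map ⟦_⟧ (ground ts)

  IsBasis : PartitionSet
  IsBasis β = ∃ λ ts → β ≡ basis ts

  length-basis : ∀ ts → length (basis ts) ≡ length ts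
  length-basis ts = trans (length-map ⟦_⟧ (ground ts)) (length-ground ts)

  basis-kinds-unique : ∀ {ts ts′ cs cs′} →
    length (map (_* k) cs) ≡ length (basis ts) → length (map (_* k) cs′) ≡ length (basis ts′) →
    zipWith _+_ (basis ts) (map (_* k) cs) ≡ zipWith _+_ (basis ts′) (map (_* k) cs′) → ts ≡ ts′
  basis-kinds-unique {ts} {ts′} {cs} {cs′} |π| |π′| eq = begin
    ts                                         ≡⟨ sym (kinds-raise-ground (fits ts cs |π|)) ⟩
    map proj₁ (zipWith raise (ground ts) cs)   ≡⟨ cong (map proj₁) (map-injective ⟦⟧-injective values≡) ⟩
    map proj₁ (zipWith raise (ground ts′) cs′) ≡⟨ kinds-raise-ground (fits ts′ cs′ |π′|) ⟩
    ts′                                        ∎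
    where
    open ≡-Reasoning
    fits : ∀ ts cs → length (map (_* k) cs) ≡ length (basis ts) → length cs ≡ length ts
    fits ts cs |π| = trans (sym (length-map (_* k) cs)) (trans |π| (length-basis ts))
    values≡ = trans (map-⟦⟧-raise (ground ts) cs) (trans eq (sym (map-⟦⟧-raise (ground ts′) cs′)))

  basis⇒R′ : ∀ β → IsBasis β → R′ a b k β
  basis⇒R′ _ (ts , refl) = ≽-codes⇒R′ (ground-≽ ts)

  basis-finite : ∀ m → 1 ≤ m → ∃ λ (L : List (List ℕ)) → ∀ β → IsBasis β → length β ≡ m → β ∈ L
  basis-finite m _ = map basis (kindLists m) , λ where
    _ (ts , refl) |β| → subst (λ n → basis ts ∈ map basis (kindLists n))
                               (trans (sym (length-basis ts)) |β|) (∈-map⁺ basis (∈-kindLists ts))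

  R′-decompose : ∀ xs → R′ a b k xs → ∃ λ β → ∃ λ π → Decomp IsBasis k xs β π
  R′-decompose _ r with R′⇒≽-codes r
  ... | ps , l , refl with ≽-linked⇒raised-ground l
  ... | cs , decreasing , |cs| , ps≡ =
    basis ts , map (_* k) cs , (ts , refl) ,
    trans (length-basis ts) (trans (length-map proj₁ ps) (sym (length-map ⟦_⟧ ps))) ,
    trans (length-map (_* k) cs) (trans |cs| (sym (length-map ⟦_⟧ ps))) ,
    decreasing-quotients-shift decreasing ,
    trans (cong (map ⟦_⟧) ps≡) (map-⟦⟧-raise (ground ts) cs)
    where ts = map proj₁ ps

  decomposition-unique : ∀ xs β π β′ π′ → R′ a b k xs →
    Decomp IsBasis k xs β π → Decomp IsBasis k xs β′ π′ → β ≡ β′ × π ≡ π′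
  decomposition-unique _ _ _ _ _ _ ((ts , refl) , |β| , |π| , shift , xs≡)
                                   ((ts′ , refl) , |β′| , |π′| , shift′ , xs≡′)
    with shift-quotients shift | shift-quotients shift′
  ... | cs , refl | cs′ , refl
    with basis-kinds-unique (trans |π| (sym |β|)) (trans |π′| (sym |β′|)) (trans (sym xs≡) xs≡′)
  ... | refl = refl , zipWith-+-cancelˡ (trans |π| (sym |β|)) (trans |π′| (sym |β|)) (trans (sym xs≡) xs≡′)

  basis+shift⇒R′ : ∀ β π → IsBasis β → IsShift k π → length π ≡ length β → R′ a b k (zipWith _+_ β π)
  basis+shift⇒R′ _ _ (ts , refl) shift _ with shift-quotients shift
  ... | cs , refl =
    subst (R′ a b k) (map-⟦⟧-raise (ground ts) cs)
          (≽-codes⇒R′ (raise-linked (ground-≽ ts) (shift-quotients-decreasing 0<k (proj₁ shift))))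

  separable : IsSeparable k (R′ a b k)
  separable = IsBasis , basis⇒R′ , basis-finite , R′-decompose , decomposition-unique , basis+shift⇒R′

mainTheorem10 : (a b k : ℕ) → 1 ≤ a → a < b → b ≤ k → IsSeparable k (R′ a b k)
mainTheorem10 _ _ _ 1≤a a<b b≤k = Residues.separable 1≤a a<b b≤k
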